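{- Let $I$ be an instance with agents $N=\{1,\dots,n\}$ on a path, strict preferences, initial assignment $\sigma_0(i)=o_i$, and let $l<k$. Let $I'$ be the instance obtained from $I$ by deleting agents $1,\dots,l-1$ and objects $o_1,\dots,o_{l-1}$ (so the agents are $l,l+1,\dots,n$ on the path in this order, the objects are $o_l,\dots,o_n$, each remaining agent's preference is the restriction of its original preference to $\{o_l,\dots,o_n\}$, and agent $i$ initially holds $o_i$). Then object $o_l$ is reachable for agent $k$ in $I$ if and only if object $o_l$ is reachable for agent $k$ in $I'$.
   Context: In an instance, agents lie on a path in index order (edges between consecutive agents), each agent $i$ has a strict preference $\succ_i$ (a linear order on the objects), and agent $i$ initially holds $o_i$. A swap exchanges the objects of two adjacent agents in the current assignment and is allowed only if both agents strictly prefer the object they receive. An object $o$ is reachable for agent $i$ if some sequence of allowed swaps from the initial assignment yields an assignment in which $i$ holds $o$. -}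

module Defs where

open import Data.Nat using (ℕ; zero; suc; _+_; _<_)
open import Data.Fin using (Fin; toℕ; _↑ʳ_)
open import Data.Product using (Σ; _×_; ∃₂)
open import Relation.Binary.PropositionalEquality using (_≡_; _≢_)
open import Relation.Binary.Construct.Closure.ReflexiveTransitive using (Star)
open import Function.Definitions using (Injective)

-- Preferences of n agents over n objects (agents and objects both indexed
-- by Fin n; object o_i is indexed by i).  Agent i's preference is given by
-- a rank function  rank i : objects → ℕ  (smaller rank = more preferred);
-- it is a strict linear order exactly when  rank i  is injective.
Ranks : ℕ → Set
Ranks n = Fin n → Fin n → ℕ

StrictPrefs : {n : ℕ} → Ranks n → Set
StrictPrefs {n} rank = (i : Fin n) → Injective _≡_ _≡_ (rank i)

Prefers : {n : ℕ} → Ranks n → Fin n → Fin n → Fin n → Set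
Prefers rank i a b = rank i a < rank i b

-- assignments: agent ↦ object held
Assignment : ℕ → Set
Assignment n = Fin n → Fin n

σ₀ : {n : ℕ} → Assignment n
σ₀ i = i

Adjacent : {n : ℕ} → Fin n → Fin n → Set
Adjacent j j' = toℕ j' ≡ suc (toℕ j)

Swapped : {n : ℕ} → Assignment n → Fin n → Fin n → Assignment n → Set
Swapped σ j j' τ =
  (τ j ≡ σ j') × (τ j' ≡ σ j) × (∀ x → x ≢ j → x ≢ j' → τ x ≡ σ x)

Step : {n : ℕ} → Ranks n → Assignment n → Assignment n → Set
Step rank σ τ = ∃₂ λ j j' →
  Adjacent j j' × Prefers rank j (σ j') (σ j) × Prefers rank j' (σ j) (σ j')
  × Swapped σ j j' τ

Reachable : {n : ℕ} → Ranks n → Fin n → Fin n → Set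
Reachable {n} rank i o =
  Σ (Assignment n) λ σ → Star (Step rank) σ₀ σ × (σ i ≡ o)

restrict : (d : ℕ) {m : ℕ} → Ranks (d + m) → Ranks m
restrict d rank i a = rank (d ↑ʳ i) (d ↑ʳ a)

-- Every swap sequence of I' is one of I in which the deleted agents keep their objects,
-- which gives "⇐".  For "⇒", follow o_l along a swap sequence of I.  While a kept agent p
-- holds o_l, every kept agent left of p holds an object it prefers to o_l, and the
-- agents from p on hold what they would hold after the swaps of I' that brought o_l to
-- p; swaps left of p do not disturb this.  If o_l is ever passed to agent l − 1, then
-- agent l holds an object it prefers to o_l from then on, so o_l never comes back.
module Submission where

open import Defs
open import Data.Nat using (ℕ; suc; _+_)
open import Data.Fin using (Fin; zero; suc; _↑ʳ_)
open import Function.Bundles using (_⇔_)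

import Data.Nat as ℕ
import Data.Nat.Properties as ℕ
open import Data.Fin using (toℕ; _↑ˡ_; splitAt; join; _≤_; _<_)
open import Data.Fin.Properties
  using (_≟_; toℕ-↑ˡ; toℕ-↑ʳ; toℕ<n; ↑ʳ-injective; splitAt-↑ˡ; splitAt-↑ʳ;
         splitAt⁻¹-↑ˡ; splitAt⁻¹-↑ʳ; join-splitAt; ≤-refl; <-cmp; <⇒≢; ≤∧≢⇒<)
open import Data.Fin.Permutation.Components using (transpose)
open import Data.Product using (Σ; _×_; _,_; proj₁; proj₂)
open import Data.Sum as Sum using (inj₁; inj₂)
open import Data.Sum.Properties using (map-id)
open import Data.Empty using (⊥-elim)
open import Function using (_∘_; mk⇔)
open import Relation.Nullary using (¬_; yes; no)
open import Relation.Nullary.Decidable using (dec-true; dec-false)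
open import Relation.Binary using (tri<; tri≈; tri>)
open import Relation.Binary.PropositionalEquality
open import Relation.Binary.Construct.Closure.ReflexiveTransitive
  using (Star; ε; _◅_; _◅◅_; gmap)

module _ {A : Set} {n : ℕ} where

  Exchange : (Fin n → A) → Fin n → Fin n → (Fin n → A) → Set
  Exchange ρ a b ρ' = (ρ' a ≡ ρ b) × (ρ' b ≡ ρ a) × (∀ x → x ≢ a → x ≢ b → ρ' x ≡ ρ x)

  Exchange-elim : ∀ {ρ ρ' : Fin n → A} {a b} (P : Fin n → A → Set) →
    Exchange ρ a b ρ' → P a (ρ b) → P b (ρ a) →
    (∀ x → x ≢ a → x ≢ b → P x (ρ x)) → ∀ x → P x (ρ' x)
  Exchange-elim {a = a} {b} P (ρ'a , ρ'b , ρ'x) Pa Pb Px x with x ≟ a | x ≟ b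
  ... | yes refl | _        = subst (P x) (sym ρ'a) Pa
  ... | no _     | yes refl = subst (P x) (sym ρ'b) Pb
  ... | no x≢a   | no x≢b   = subst (P x) (sym (ρ'x x x≢a x≢b)) (Px x x≢a x≢b)

  Exchange-transpose : ∀ (τ : Fin n → A) {a b} → a ≢ b →
                       Exchange τ a b (τ ∘ transpose a b)
  Exchange-transpose τ {a} {b} a≢b = cong τ matchˡ , cong τ matchʳ , mismatch
    where
    matchˡ : transpose a b a ≡ b
    matchˡ rewrite dec-true (a ≟ a) refl = refl
    matchʳ : transpose a b b ≡ a
    matchʳ rewrite dec-false (b ≟ a) (a≢b ∘ sym) | dec-true (b ≟ b) refl = refl
    mismatch : ∀ x → x ≢ a → x ≢ b → τ (transpose a b x) ≡ τ x
    mismatch x x≢a x≢b rewrite dec-false (x ≟ a) x≢a | dec-false (x ≟ b) x≢b = refl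

  Updated : (Fin n → A) → Fin n → A → (Fin n → A) → Set
  Updated ρ a c ρ' = (ρ' a ≡ c) × (∀ x → x ≢ a → ρ' x ≡ ρ x)

  Updated-elim : ∀ {ρ ρ' : Fin n → A} {a c} (P : Fin n → A → Set) →
    Updated ρ a c ρ' → P a c → (∀ x → x ≢ a → P x (ρ x)) → ∀ x → P x (ρ' x)
  Updated-elim {a = a} P (ρ'a , ρ'x) Pa Px x with x ≟ a
  ... | yes refl = subst (P x) (sym ρ'a) Pa
  ... | no x≢a   = subst (P x) (sym (ρ'x x x≢a)) (Px x x≢a)

Adjacent⇒< : ∀ {n} {a b : Fin n} → Adjacent a b → a < b
Adjacent⇒< {a = a} adj = subst (toℕ a ℕ.<_) (sym adj) (ℕ.n<1+n (toℕ a))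

<-Adjacent⇒≤ : ∀ {n} {a b x : Fin n} → Adjacent a b → x < b → x ≤ a
<-Adjacent⇒≤ {x = x} adj x<b = ℕ.≤-pred (subst (suc (toℕ x) ℕ.≤_) adj x<b)

Adjacent⇒≢zero : ∀ {m} {a b : Fin (suc m)} → Adjacent a b → b ≢ zero
Adjacent⇒≢zero adj refl = ℕ.0≢1+n adj

data Side (d n : ℕ) : Fin (d + n) → Set where
  deleted : (i : Fin d) → Side d n (i ↑ˡ n)
  kept    : (x : Fin n) → Side d n (d ↑ʳ x)

side : ∀ d {n} (j : Fin (d + n)) → Side d n j
side d j with splitAt d j in eq
... | inj₁ i = subst (Side d _) (splitAt⁻¹-↑ˡ eq) (deleted i)
... | inj₂ x = subst (Side d _) (splitAt⁻¹-↑ʳ eq) (kept x)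

module _ {d n : ℕ} where

  ↑ʳ≢↑ˡ : (x : Fin n) (i : Fin d) → d ↑ʳ x ≢ i ↑ˡ n
  ↑ʳ≢↑ˡ x i eq = ℕ.m+n≮m d (toℕ x) (subst (ℕ._< d) toℕ-eq (toℕ<n i))
    where
    toℕ-eq : toℕ i ≡ d + toℕ x
    toℕ-eq = trans (sym (toℕ-↑ˡ i n)) (trans (cong toℕ (sym eq)) (toℕ-↑ʳ d x))

  ¬Adjacent-↑ʳ-↑ˡ : (a : Fin n) (i : Fin d) → ¬ Adjacent (d ↑ʳ a) (i ↑ˡ n)
  ¬Adjacent-↑ʳ-↑ˡ a i adj =
    ℕ.m+1+n≰m d (subst (ℕ._≤ d) toℕ-eq (ℕ.<⇒≤ (toℕ<n i)))
    where
    toℕ-eq : toℕ i ≡ d + suc (toℕ a)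
    toℕ-eq = begin
      toℕ i                ≡⟨ sym (toℕ-↑ˡ i n) ⟩
      toℕ (i ↑ˡ n)         ≡⟨ adj ⟩
      suc (toℕ (d ↑ʳ a))   ≡⟨ cong suc (toℕ-↑ʳ d a) ⟩
      suc (d + toℕ a)      ≡⟨ sym (ℕ.+-suc d (toℕ a)) ⟩
      d + suc (toℕ a)      ∎
      where open ≡-Reasoning

  Adjacent-↑ʳ⁺ : {a b : Fin n} → Adjacent a b → Adjacent (d ↑ʳ a) (d ↑ʳ b)
  Adjacent-↑ʳ⁺ {a} {b} adj = begin
    toℕ (d ↑ʳ b)        ≡⟨ toℕ-↑ʳ d b ⟩
    d + toℕ b           ≡⟨ cong (d +_) adj ⟩
    d + suc (toℕ a)     ≡⟨ ℕ.+-suc d (toℕ a) ⟩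
    suc (d + toℕ a)     ≡⟨ cong suc (sym (toℕ-↑ʳ d a)) ⟩
    suc (toℕ (d ↑ʳ a))  ∎
    where open ≡-Reasoning

  Adjacent-↑ʳ⁻ : {a b : Fin n} → Adjacent (d ↑ʳ a) (d ↑ʳ b) → Adjacent a b
  Adjacent-↑ʳ⁻ {a} {b} adj = ℕ.+-cancelˡ-≡ d (toℕ b) (suc (toℕ a)) (begin
    d + toℕ b           ≡⟨ sym (toℕ-↑ʳ d b) ⟩
    toℕ (d ↑ʳ b)        ≡⟨ adj ⟩
    suc (toℕ (d ↑ʳ a))  ≡⟨ cong suc (toℕ-↑ʳ d a) ⟩
    suc (d + toℕ a)     ≡⟨ sym (ℕ.+-suc d (toℕ a)) ⟩
    d + suc (toℕ a)     ∎)
    where open ≡-Reasoning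

Adjacent-↑ˡ-↑ʳ : ∀ {d m} (i : Fin d) (b : Fin (suc m)) → Adjacent (i ↑ˡ suc m) (d ↑ʳ b) → b ≡ zero
Adjacent-↑ˡ-↑ʳ i zero    adj = refl
Adjacent-↑ˡ-↑ʳ {d} {m} i (suc c) adj = ⊥-elim (ℕ.m+1+n≰m d (subst (ℕ._≤ d) toℕ-eq (toℕ<n i)))
  where
  toℕ-eq : suc (toℕ i) ≡ d + suc (toℕ c)
  toℕ-eq = begin
    suc (toℕ i)             ≡⟨ cong suc (sym (toℕ-↑ˡ i (suc m))) ⟩
    suc (toℕ (i ↑ˡ suc m))  ≡⟨ sym adj ⟩
    toℕ (d ↑ʳ suc c)        ≡⟨ toℕ-↑ʳ d (suc c) ⟩
    d + suc (toℕ c)         ∎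
    where open ≡-Reasoning

module _ {n : ℕ} (rank : Ranks n) where

  Prefers⇒≢ : ∀ {i a b} → Prefers rank i a b → a ≢ b
  Prefers⇒≢ a≻b refl = ℕ.<-irrefl refl a≻b

  Step-respˡ : ∀ {σ σ' τ} → σ ≗ σ' → Step rank σ τ → Step rank σ' τ
  Step-respˡ {σ} {σ'} σ≗σ' (j , j' , adj , pj , pj' , τj , τj' , τx) =
    j , j' , adj , prefers j pj , prefers j' pj' ,
    trans τj (σ≗σ' j') , trans τj' (σ≗σ' j) , λ x x≢j x≢j' → trans (τx x x≢j x≢j') (σ≗σ' x)
    where
    prefers : ∀ i {u v} → Prefers rank i (σ u) (σ v) → Prefers rank i (σ' u) (σ' v)
    prefers i {u} {v} = subst₂ (Prefers rank i) (σ≗σ' u) (σ≗σ' v)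

  Star-respˡ : ∀ {σ σ' τ} → σ ≗ σ' → Star (Step rank) σ τ →
               Σ (Assignment n) λ τ' → Star (Step rank) σ' τ' × τ ≗ τ'
  Star-respˡ {σ' = σ'} σ≗σ' ε       = σ' , ε , σ≗σ'
  Star-respˡ {τ = τ}   σ≗σ' (s ◅ r) = τ , Step-respˡ σ≗σ' s ◅ r , λ _ → refl

module Embedding {d n : ℕ} (rank : Ranks (d + n)) where

  embed : Assignment n → Assignment (d + n)
  embed τ = join d n ∘ Sum.map₂ τ ∘ splitAt d

  embed-↑ʳ : ∀ τ y → embed τ (d ↑ʳ y) ≡ d ↑ʳ τ y
  embed-↑ʳ τ y rewrite splitAt-↑ʳ d n y = refl

  embed-↑ˡ : ∀ τ i → embed τ (i ↑ˡ n) ≡ i ↑ˡ n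
  embed-↑ˡ τ i rewrite splitAt-↑ˡ d i n = refl

  embed-σ₀ : embed σ₀ ≗ σ₀
  embed-σ₀ x = trans (cong (join d n) (map-id (splitAt d x))) (join-splitAt d n x)

  Step-embed : ∀ {τ τ'} → Step (restrict d rank) τ τ' → Step rank (embed τ) (embed τ')
  Step-embed {τ} {τ'} (a , b , adj , pa , pb , τ'a , τ'b , τ'x) =
    d ↑ʳ a , d ↑ʳ b , Adjacent-↑ʳ⁺ adj , pa' , pb' , ea , eb , ex
    where
    pa' : Prefers rank (d ↑ʳ a) (embed τ (d ↑ʳ b)) (embed τ (d ↑ʳ a))
    pa' rewrite embed-↑ʳ τ a | embed-↑ʳ τ b = pa
    pb' : Prefers rank (d ↑ʳ b) (embed τ (d ↑ʳ a)) (embed τ (d ↑ʳ b))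
    pb' rewrite embed-↑ʳ τ a | embed-↑ʳ τ b = pb
    ea : embed τ' (d ↑ʳ a) ≡ embed τ (d ↑ʳ b)
    ea rewrite embed-↑ʳ τ' a | embed-↑ʳ τ b = cong (d ↑ʳ_) τ'a
    eb : embed τ' (d ↑ʳ b) ≡ embed τ (d ↑ʳ a)
    eb rewrite embed-↑ʳ τ' b | embed-↑ʳ τ a = cong (d ↑ʳ_) τ'b
    ex : ∀ x → x ≢ d ↑ʳ a → x ≢ d ↑ʳ b → embed τ' x ≡ embed τ x
    ex x x≢a x≢b with side d x
    ... | deleted i = trans (embed-↑ˡ τ' i) (sym (embed-↑ˡ τ i))
    ... | kept y rewrite embed-↑ʳ τ' y | embed-↑ʳ τ y =
      cong (d ↑ʳ_) (τ'x y (x≢a ∘ cong (d ↑ʳ_)) (x≢b ∘ cong (d ↑ʳ_)))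

  Reachable-↑ʳ : ∀ {x y} → Reachable (restrict d rank) x y → Reachable rank (d ↑ʳ x) (d ↑ʳ y)
  Reachable-↑ʳ {x} (τ , r , τx) with Star-respˡ rank embed-σ₀ (gmap embed Step-embed r)
  ... | σ , r' , embedτ≗σ =
    σ , r' , trans (sym (embedτ≗σ (d ↑ʳ x))) (trans (embed-↑ʳ τ x) (cong (d ↑ʳ_) τx))

module Tracking {d m : ℕ} (rank : Ranks (d + suc m)) where

  Kept : Set
  Kept = Fin (suc m) → Fin (d + suc m)

  o : Fin (d + suc m)
  o = d ↑ʳ zero

  PrefersToO : Fin (suc m) → Fin (d + suc m) → Set
  PrefersToO x v = Prefers rank (d ↑ʳ x) v o

  data KeptMove (ρ ρ' : Kept) : Set where
    untouched : ρ' ≗ ρ → KeptMove ρ ρ'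
    entered   : ∀ c → Prefers rank (d ↑ʳ zero) c (ρ zero) → Updated ρ zero c ρ' →
                KeptMove ρ ρ'
    exchanged : ∀ a b → Adjacent a b → Prefers rank (d ↑ʳ a) (ρ b) (ρ a) →
                Prefers rank (d ↑ʳ b) (ρ a) (ρ b) → Exchange ρ a b ρ' → KeptMove ρ ρ'

  Step⇒KeptMove : ∀ {σ σ'} → Step rank σ σ' → KeptMove (σ ∘ (d ↑ʳ_)) (σ' ∘ (d ↑ʳ_))
  Step⇒KeptMove {σ} (j , j' , adj , pj , pj' , σ'j , σ'j' , σ'x) with side d j | side d j'
  ... | deleted i | deleted i' = untouched λ x → σ'x (d ↑ʳ x) (↑ʳ≢↑ˡ x i) (↑ʳ≢↑ˡ x i')
  ... | kept a    | deleted i' = ⊥-elim (¬Adjacent-↑ʳ-↑ˡ a i' adj)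
  ... | kept a    | kept b     = exchanged a b (Adjacent-↑ʳ⁻ adj) pj pj'
    (σ'j , σ'j' , λ x x≢a x≢b → σ'x (d ↑ʳ x) (x≢a ∘ ↑ʳ-injective d x a) (x≢b ∘ ↑ʳ-injective d x b))
  ... | deleted i | kept b with Adjacent-↑ˡ-↑ʳ i b adj
  ...   | refl = entered (σ (i ↑ˡ suc m)) pj'
    (σ'j' , λ x x≢0 → σ'x (d ↑ʳ x) (↑ʳ≢↑ˡ x i) (x≢0 ∘ ↑ʳ-injective d x zero))

  -- The shadow is reached in I' by the swaps that carried o_l to the holder; from the
  -- holder on, the kept agents hold in I exactly what they hold in the shadow.
  record TrackedAt (ρ : Kept) (holder : Fin (suc m)) : Set where
    field
      shadow           : Assignment (suc m)
      shadow-reachable : Star (Step (restrict d rank)) σ₀ shadow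
      holds-o          : ρ holder ≡ o
      before-prefer    : ∀ x → x < holder → PrefersToO x (ρ x)
      from-agree       : ∀ x → holder ≤ x → ρ x ≡ d ↑ʳ shadow x
      after-lack       : ∀ x → holder < x → ρ x ≢ o

  record Escaped (ρ : Kept) : Set where
    field
      absent        : ∀ x → ρ x ≢ o
      first-prefers : PrefersToO zero (ρ zero)

  data Invariant (ρ : Kept) : Set where
    tracked : ∀ p → TrackedAt ρ p → Invariant ρ
    escaped : Escaped ρ → Invariant ρ

  Invariant-σ₀ : Invariant (σ₀ ∘ (d ↑ʳ_))
  Invariant-σ₀ = tracked zero record
    { shadow           = σ₀
    ; shadow-reachable = ε
    ; holds-o          = refl
    ; before-prefer    = λ _ ()
    ; from-agree       = λ _ _ → refl
    ; after-lack       = λ x 0<x eq → <⇒≢ 0<x (sym (↑ʳ-injective d x zero eq))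
    }

  TrackedAt-behind : ∀ {ρ ρ' p} → TrackedAt ρ p → (∀ x → p ≤ x → ρ' x ≡ ρ x) →
    (∀ x → x < p → PrefersToO x (ρ' x)) → TrackedAt ρ' p
  TrackedAt-behind {p = p} t same prefer = record
    { shadow           = shadow
    ; shadow-reachable = shadow-reachable
    ; holds-o          = trans (same p ≤-refl) holds-o
    ; before-prefer    = prefer
    ; from-agree       = λ x p≤x → trans (same x p≤x) (from-agree x p≤x)
    ; after-lack       = λ x p<x → subst (_≢ o) (sym (same x (ℕ.<⇒≤ p<x))) (after-lack x p<x)
    }
    where open TrackedAt t

  Escaped-move : ∀ {ρ ρ'} → KeptMove ρ ρ' → Escaped ρ → Escaped ρ'
  Escaped-move (untouched same) e = record
    { absent        = λ x → subst (_≢ o) (sym (same x)) (absent x)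
    ; first-prefers = subst (PrefersToO zero) (sym (same zero)) first-prefers
    }
    where open Escaped e
  Escaped-move (entered c c≻ρ0 upd) e = record
    { absent        = Updated-elim (λ _ v → v ≢ o) upd (Prefers⇒≢ rank c≻o) (λ x _ → absent x)
    ; first-prefers = subst (PrefersToO zero) (sym (proj₁ upd)) c≻o
    }
    where
    open Escaped e
    c≻o : PrefersToO zero c
    c≻o = ℕ.<-trans c≻ρ0 first-prefers
  Escaped-move (exchanged a b adj pa _ ex) e = record
    { absent        = Exchange-elim (λ _ v → v ≢ o) ex (absent b) (absent a) (λ x _ _ → absent x)
    ; first-prefers = Exchange-elim (λ x v → x ≡ zero → PrefersToO x v) ex
        (λ { refl → ℕ.<-trans pa first-prefers })
        (λ b≡0 → ⊥-elim (Adjacent⇒≢zero adj b≡0))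
        (λ { x _ _ refl → first-prefers })
        zero refl
    }
    where open Escaped e

  shadow-exchange : ∀ {ρ ρ' p a b} → TrackedAt ρ p → p ≤ a → Adjacent a b →
    Prefers rank (d ↑ʳ a) (ρ b) (ρ a) → Prefers rank (d ↑ʳ b) (ρ a) (ρ b) →
    Exchange ρ a b ρ' →
    Σ (Assignment (suc m)) λ τ → Star (Step (restrict d rank)) σ₀ τ ×
                                 (∀ x → p ≤ x → ρ' x ≡ d ↑ʳ τ x)
  shadow-exchange {ρ' = ρ'} {p = p} {a = a} {b = b} t p≤a adj pa pb ex =
    shadow' , shadow-reachable ◅◅ (shadow-step ◅ ε) , agree
    where
    open TrackedAt t
    p≤b : p ≤ b
    p≤b = ℕ.<⇒≤ (ℕ.≤-<-trans p≤a (Adjacent⇒< adj))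
    shadow' : Assignment (suc m)
    shadow' = shadow ∘ transpose a b
    shadow-ex : Exchange shadow a b shadow'
    shadow-ex = Exchange-transpose shadow (<⇒≢ (Adjacent⇒< adj))
    shadow-step : Step (restrict d rank) shadow shadow'
    shadow-step = a , b , adj
      , subst₂ (Prefers rank (d ↑ʳ a)) (from-agree b p≤b) (from-agree a p≤a) pa
      , subst₂ (Prefers rank (d ↑ʳ b)) (from-agree a p≤a) (from-agree b p≤b) pb
      , shadow-ex
    agree : ∀ x → p ≤ x → ρ' x ≡ d ↑ʳ shadow' x
    agree = Exchange-elim (λ x v → p ≤ x → v ≡ d ↑ʳ shadow' x) ex
      (λ _ → trans (from-agree b p≤b) (cong (d ↑ʳ_) (sym (proj₁ shadow-ex))))
      (λ _ → trans (from-agree a p≤a) (cong (d ↑ʳ_) (sym (proj₁ (proj₂ shadow-ex)))))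
      (λ x x≢a x≢b p≤x →
         trans (from-agree x p≤x) (cong (d ↑ʳ_) (sym (proj₂ (proj₂ shadow-ex) x x≢a x≢b))))

  TrackedAt-ahead : ∀ {ρ ρ' p a b} → TrackedAt ρ p → p ≤ a → Adjacent a b →
    Prefers rank (d ↑ʳ a) (ρ b) (ρ a) → Prefers rank (d ↑ʳ b) (ρ a) (ρ b) →
    Exchange ρ a b ρ' → Invariant ρ'
  TrackedAt-ahead {ρ} {ρ'} {p} {a} {b} t p≤a adj pa pb ex
    with shadow-exchange t p≤a adj pa pb ex | a ≟ p
  ... | τ , reach , agree | yes refl = tracked b record
    { shadow           = τ
    ; shadow-reachable = reach
    ; holds-o          = trans (proj₁ (proj₂ ex)) holds-o
    ; before-prefer    = Exchange-elim (λ x v → x < b → PrefersToO x v) ex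
        (λ _ → subst (Prefers rank (d ↑ʳ a) (ρ b)) holds-o pa)
        (λ b<b → ⊥-elim (ℕ.<-irrefl refl b<b))
        (λ x x≢a _ x<b → before-prefer x (≤∧≢⇒< (<-Adjacent⇒≤ adj x<b) x≢a))
    ; from-agree       = λ x b≤x → agree x (ℕ.<⇒≤ (ℕ.<-≤-trans a<b b≤x))
    ; after-lack       = Exchange-elim (λ x v → b < x → v ≢ o) ex
        (λ b<a → ⊥-elim (ℕ.<-asym a<b b<a))
        (λ b<b → ⊥-elim (ℕ.<-irrefl refl b<b))
        (λ x _ _ b<x → after-lack x (ℕ.<-trans a<b b<x))
    }
    where
    open TrackedAt t
    a<b : a < b
    a<b = Adjacent⇒< adj
  ... | τ , reach , agree | no a≢p = tracked p record
    { shadow           = τ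
    ; shadow-reachable = reach
    ; holds-o          = trans (unchanged p (<⇒≢ p<a) (<⇒≢ p<b)) holds-o
    ; before-prefer    = λ x x<p →
        subst (PrefersToO x)
          (sym (unchanged x (<⇒≢ (ℕ.<-trans x<p p<a)) (<⇒≢ (ℕ.<-trans x<p p<b))))
          (before-prefer x x<p)
    ; from-agree       = agree
    ; after-lack       = Exchange-elim (λ x v → p < x → v ≢ o) ex
        (λ _ → after-lack b p<b) (λ _ → after-lack a p<a) (λ x _ _ → after-lack x)
    }
    where
    open TrackedAt t
    unchanged : ∀ x → x ≢ a → x ≢ b → ρ' x ≡ ρ x
    unchanged = proj₂ (proj₂ ex)
    p<a : p < a
    p<a = ≤∧≢⇒< p≤a (a≢p ∘ sym)
    p<b : p < b
    p<b = ℕ.<-trans p<a (Adjacent⇒< adj)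

  TrackedAt-entered : ∀ {ρ ρ' p c} → Prefers rank (d ↑ʳ zero) c (ρ zero) →
    Updated ρ zero c ρ' → TrackedAt ρ p → Invariant ρ'
  TrackedAt-entered {p = zero} {c} c≻ρ0 upd t = escaped record
    { absent        = Updated-elim (λ _ v → v ≢ o) upd (Prefers⇒≢ rank c≻o)
        (λ x x≢0 → after-lack x (≤∧≢⇒< ℕ.z≤n (x≢0 ∘ sym)))
    ; first-prefers = subst (PrefersToO zero) (sym (proj₁ upd)) c≻o
    }
    where
    open TrackedAt t
    c≻o : PrefersToO zero c
    c≻o = subst (Prefers rank (d ↑ʳ zero) c) holds-o c≻ρ0
  TrackedAt-entered {p = suc p} c≻ρ0 upd t = tracked (suc p) (TrackedAt-behind t
    (λ x p<x → proj₂ upd x (<⇒≢ (ℕ.<-≤-trans ℕ.z<s p<x) ∘ sym))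
    (Updated-elim (λ x v → x < suc p → PrefersToO x v) upd
      (λ _ → ℕ.<-trans c≻ρ0 (before-prefer zero ℕ.z<s)) (λ x _ → before-prefer x)))
    where open TrackedAt t

  TrackedAt-exchanged : ∀ {ρ ρ' p a b} → Adjacent a b →
    Prefers rank (d ↑ʳ a) (ρ b) (ρ a) → Prefers rank (d ↑ʳ b) (ρ a) (ρ b) →
    Exchange ρ a b ρ' → TrackedAt ρ p → Invariant ρ'
  TrackedAt-exchanged {p = p} {a} {b} adj pa pb ex t with <-cmp b p
  ... | tri< b<p _ _ = tracked p (TrackedAt-behind t
    (λ x p≤x → proj₂ (proj₂ ex) x (<⇒≢ (ℕ.<-≤-trans a<p p≤x) ∘ sym)
                                   (<⇒≢ (ℕ.<-≤-trans b<p p≤x) ∘ sym))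
    (Exchange-elim (λ x v → x < p → PrefersToO x v) ex
      (λ _ → ℕ.<-trans pa (before-prefer a a<p))
      (λ _ → ℕ.<-trans pb (before-prefer b b<p))
      (λ x _ _ → before-prefer x)))
    where
    open TrackedAt t
    a<p : a < p
    a<p = ℕ.<-trans (Adjacent⇒< adj) b<p
  -- a would receive o_l, yet it already prefers its own object to o_l
  ... | tri≈ _ refl _ = ⊥-elim (ℕ.<-asym (subst (λ v → Prefers rank (d ↑ʳ a) v _) holds-o pa)
                                         (before-prefer a (Adjacent⇒< adj)))
    where open TrackedAt t
  ... | tri> _ _ p<b = TrackedAt-ahead t (<-Adjacent⇒≤ adj p<b) adj pa pb ex

  TrackedAt-move : ∀ {ρ ρ' p} → KeptMove ρ ρ' → TrackedAt ρ p → Invariant ρ'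
  TrackedAt-move {p = p} (untouched same) t = tracked p (TrackedAt-behind t (λ x _ → same x)
    (λ x x<p → subst (PrefersToO x) (sym (same x)) (TrackedAt.before-prefer t x x<p)))
  TrackedAt-move (entered _ c≻ρ0 upd)          = TrackedAt-entered c≻ρ0 upd
  TrackedAt-move (exchanged _ _ adj pa pb ex) = TrackedAt-exchanged adj pa pb ex

  Invariant-move : ∀ {ρ ρ'} → KeptMove ρ ρ' → Invariant ρ → Invariant ρ'
  Invariant-move mv (tracked p t) = TrackedAt-move mv t
  Invariant-move mv (escaped e)   = escaped (Escaped-move mv e)

  Invariant-Star : ∀ {σ σ'} → Star (Step rank) σ σ' →
                   Invariant (σ ∘ (d ↑ʳ_)) → Invariant (σ' ∘ (d ↑ʳ_))
  Invariant-Star ε       inv = inv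
  Invariant-Star (s ◅ r) inv = Invariant-Star r (Invariant-move (Step⇒KeptMove s) inv)

  Invariant⇒Reachable : ∀ {ρ} x → Invariant ρ → ρ x ≡ o → Reachable (restrict d rank) x zero
  Invariant⇒Reachable x (escaped e) ρx≡o = ⊥-elim (Escaped.absent e x ρx≡o)
  Invariant⇒Reachable x (tracked p t) ρx≡o with <-cmp x p
  ... | tri< x<p _ _ = ⊥-elim (Prefers⇒≢ rank (before-prefer x x<p) ρx≡o)
    where open TrackedAt t
  ... | tri≈ _ refl _ =
    shadow , shadow-reachable , ↑ʳ-injective d _ _ (trans (sym (from-agree x ≤-refl)) ρx≡o)
    where open TrackedAt t
  ... | tri> _ _ p<x = ⊥-elim (after-lack x p<x ρx≡o)
    where open TrackedAt t

  Reachable-↑ʳ⁻ : ∀ x → Reachable rank (d ↑ʳ x) o → Reachable (restrict d rank) x zero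
  Reachable-↑ʳ⁻ x (σ , r , σx≡o) = Invariant⇒Reachable x (Invariant-Star r Invariant-σ₀) σx≡o

corollary1 : (d m : ℕ) (rank : Ranks (d + suc m)) → StrictPrefs rank →
    (k : Fin m) →
    Reachable rank (d ↑ʳ suc k) (d ↑ʳ zero)
      ⇔ Reachable (restrict d rank) (suc k) zero
corollary1 d m rank _ k =
  mk⇔ (Tracking.Reachable-↑ʳ⁻ rank (suc k)) (Embedding.Reachable-↑ʳ rank)
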